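{- Let $A$ and $B$ be $0,1$-matrices. Suppose that $A$ is $(a_1,a_2,a_3)$-coverable and $B$ is $(b_1,b_2,b_3)$-coverable. Then $\mathrm{R}_{\mathbb{B}}(A\otimes B)\le a_1b_1+a_2b_2+a_3b_3$.
   Context: The Boolean rank $\mathrm{R}_{\mathbb{B}}(A)$ of a $0,1$-matrix $A$ is the smallest number of all-ones combinatorial rectangles needed to cover all $1$-entries of $A$. A collection of $0,1$-matrices of the same size as $A$ covers $A$ if for every $i,j$: $A_{i,j}=1$ iff some matrix of the collection has a $1$ in entry $(i,j)$. A $0,1$-matrix $A$ is $(a_1,a_2,a_3)$-coverable if there exist three matrices $A_1,A_2,A_3$ with $\mathrm{R}_{\mathbb{B}}(A_i)\le a_i$ for all $i\in[3]$ such that every two of them cover $A$. The Kronecker product $A\otimes B$ is the block matrix whose $(i,j)$-th block is $A_{i,j}\cdot B$. -}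

module Defs where

open import Data.Nat using (ℕ; _*_; _+_; _≤_)
open import Data.Fin using (Fin; remQuot)
open import Data.Bool using (Bool; true; false; _∧_; _∨_)
open import Data.Product using (Σ; ∃; _×_; _,_; proj₁; proj₂)
open import Relation.Binary.PropositionalEquality using (_≡_)

Matrix : ℕ → ℕ → Set
Matrix m n = Fin m → Fin n → Bool

Rectangle : ℕ → ℕ → Set
Rectangle m n = (Fin m → Bool) × (Fin n → Bool)

rectMatrix : ∀ {m n} → Rectangle m n → Matrix m n
rectMatrix (R , C) i j = R i ∧ C j

inSome : ∀ {m n} (k : ℕ) → (Fin k → Rectangle m n) → Fin m → Fin n → Set
inSome k rs i j = Σ (Fin k) λ t → rectMatrix (rs t) i j ≡ true

-- R_B(A) ≤ r : the 1-entries of A are covered exactly by r all-ones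
-- rectangles (some possibly empty), i.e. A(i,j)=1 iff (i,j) is in one of them.
BRankAtMost : ∀ {m n} → Matrix m n → ℕ → Set
BRankAtMost {m} {n} A r =
  Σ (Fin r → Rectangle m n) λ rs →
    ∀ i j → (A i j ≡ true → inSome r rs i j) × (inSome r rs i j → A i j ≡ true)

Covers2 : ∀ {m n} → Matrix m n → Matrix m n → Matrix m n → Set
Covers2 X Y A = ∀ i j → A i j ≡ (X i j ∨ Y i j)

Coverable : ∀ {m n} → Matrix m n → ℕ → ℕ → ℕ → Set
Coverable {m} {n} A a₁ a₂ a₃ =
  Σ (Matrix m n) λ A₁ → Σ (Matrix m n) λ A₂ → Σ (Matrix m n) λ A₃ →
    BRankAtMost A₁ a₁ × BRankAtMost A₂ a₂ × BRankAtMost A₃ a₃ ×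
    Covers2 A₁ A₂ A × Covers2 A₁ A₃ A × Covers2 A₂ A₃ A

-- Kronecker product: rows of A⊗B indexed by Fin (m*p) ≅ Fin m × Fin p
-- (block index first), similarly columns.
_⊗_ : ∀ {m n p q} → Matrix m n → Matrix p q → Matrix (m * p) (n * q)
_⊗_ {m} {n} {p} {q} A B i j =
  let (i₁ , i₂) = remQuot {m} p i
      (j₁ , j₂) = remQuot {n} q j
  in A i₁ j₁ ∧ B i₂ j₂

-- An entry of A is 1 exactly when at least two of A₁, A₂, A₃ have a 1 there, and likewise for B.
-- Two 2-element subsets of {1, 2, 3} meet, so A ⊗ B = A₁ ⊗ B₁ ∨ A₂ ⊗ B₂ ∨ A₃ ⊗ B₃ entrywise.
-- Boolean rank is submultiplicative under ⊗ (take products of rectangles) and subadditive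
-- under entrywise ∨ (concatenate the rectangle families), which gives the bound.
module Submission where

open import Defs
open import Algebra.Bundles using (CommutativeMonoid)
open import Data.Bool using (Bool; true; false; _∧_; _∨_)
open import Data.Bool.Properties using (∧-commutativeMonoid; ∧-conicalˡ; ∧-conicalʳ; ∨-identityʳ)
open import Algebra.Properties.CommutativeSemigroup
  (CommutativeMonoid.commutativeSemigroup ∧-commutativeMonoid) using (interchange)
open import Data.Fin using (Fin; remQuot; combine; splitAt; _↑ˡ_; _↑ʳ_)
open import Data.Fin.Properties using (remQuot-combine; splitAt-↑ˡ; splitAt-↑ʳ)
open import Data.Nat using (ℕ; _*_; _+_)
open import Data.Product using (Σ; _×_; _,_; proj₁; proj₂)
open import Data.Sum using (_⊎_; inj₁; inj₂; [_,_]′) renaming (map to ⊎-map)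
open import Data.Vec.Functional using (_++_)
open import Relation.Binary.PropositionalEquality using (_≡_; refl; sym; trans; cong; subst)

private
  variable
    m n p q a b r s : ℕ

∧-true : ∀ {x y} → x ≡ true → y ≡ true → x ∧ y ≡ true
∧-true refl refl = refl

∨-true⁺ : ∀ {x y} → x ≡ true ⊎ y ≡ true → x ∨ y ≡ true
∨-true⁺ {true}  _        = refl
∨-true⁺ {false} (inj₂ e) = e

∨-true⁻ : ∀ x {y} → x ∨ y ≡ true → x ≡ true ⊎ y ≡ true
∨-true⁻ true  _ = inj₁ refl
∨-true⁻ false e = inj₂ e

PairwiseCover : Bool → Bool → Bool → Bool → Set
PairwiseCover x a₁ a₂ a₃ = (x ≡ a₁ ∨ a₂) × (x ≡ a₁ ∨ a₃) × (x ≡ a₂ ∨ a₃)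

pairwiseCover⇒cover : ∀ a₁ a₂ a₃ {x} → PairwiseCover x a₁ a₂ a₃ → x ≡ (a₁ ∨ a₂) ∨ a₃
pairwiseCover⇒cover true  _ _ (refl , _ , _)    = refl
pairwiseCover⇒cover false _ _ (_ , _ , x≡a₂∨a₃) = x≡a₂∨a₃

pairwiseCover-∧ : ∀ a₁ a₂ a₃ b₁ b₂ b₃ {x y} →
  PairwiseCover x a₁ a₂ a₃ → PairwiseCover y b₁ b₂ b₃ →
  x ∧ y ≡ (a₁ ∧ b₁ ∨ a₂ ∧ b₂) ∨ a₃ ∧ b₃
pairwiseCover-∧ true  true  true  b₁ b₂ b₃ (refl , _ , _)  hy                = pairwiseCover⇒cover b₁ b₂ b₃ hy
pairwiseCover-∧ true  true  false b₁ b₂ _  (refl , _ , _)  (y≡b₁∨b₂ , _ , _) =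
  trans y≡b₁∨b₂ (sym (∨-identityʳ (b₁ ∨ b₂)))
pairwiseCover-∧ true  false true  b₁ _  b₃ (refl , _ , _)  (_ , y≡b₁∨b₃ , _) =
  trans y≡b₁∨b₃ (cong (_∨ b₃) (sym (∨-identityʳ b₁)))
pairwiseCover-∧ true  false false _  _  _  (refl , _ , ()) _
pairwiseCover-∧ false true  true  _  _  _  (refl , _ , _)  (_ , _ , y≡b₂∨b₃) = y≡b₂∨b₃
pairwiseCover-∧ false true  false _  _  _  (refl , () , _) _
pairwiseCover-∧ false false true  _  _  _  (refl , () , _) _
pairwiseCover-∧ false false false _  _  _  (refl , _ , _)  _                 = refl

_⊗ᵛ_ : (Fin m → Bool) → (Fin p → Bool) → Fin (m * p) → Bool
_⊗ᵛ_ {m = m} {p = p} u v i = u (proj₁ (remQuot {m} p i)) ∧ v (proj₂ (remQuot {m} p i))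

_⊗ᴿ_ : Rectangle m n → Rectangle p q → Rectangle (m * p) (n * q)
(R , C) ⊗ᴿ (R′ , C′) = R ⊗ᵛ R′ , C ⊗ᵛ C′

rectMatrix-⊗ : (ρ : Rectangle m n) (σ : Rectangle p q) →
  ∀ i j → rectMatrix (ρ ⊗ᴿ σ) i j ≡ (rectMatrix ρ ⊗ rectMatrix σ) i j
rectMatrix-⊗ {m = m} {n} {p} {q} (R , C) (R′ , C′) i j =
  interchange (R (proj₁ (remQuot {m} p i))) (R′ (proj₂ (remQuot {m} p i)))
              (C (proj₁ (remQuot {n} q j))) (C′ (proj₂ (remQuot {n} q j)))

_⊗ᶠ_ : (Fin a → Rectangle m n) → (Fin b → Rectangle p q) → Fin (a * b) → Rectangle (m * p) (n * q)
_⊗ᶠ_ {a = a} {b = b} ρs σs t = ρs (proj₁ (remQuot {a} b t)) ⊗ᴿ σs (proj₂ (remQuot {a} b t))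

module _ (ρs : Fin a → Rectangle m n) (σs : Fin b → Rectangle p q) (i : Fin (m * p)) (j : Fin (n * q)) where

  inSome-⊗⁺ : ∀ t₁ t₂ → (rectMatrix (ρs t₁) ⊗ rectMatrix (σs t₂)) i j ≡ true →
    inSome (a * b) (ρs ⊗ᶠ σs) i j
  inSome-⊗⁺ t₁ t₂ e = combine t₁ t₂ ,
    subst (λ (u₁ , u₂) → rectMatrix (ρs u₁ ⊗ᴿ σs u₂) i j ≡ true) (sym (remQuot-combine t₁ t₂))
      (trans (rectMatrix-⊗ (ρs t₁) (σs t₂) i j) e)

  inSome-⊗⁻ : inSome (a * b) (ρs ⊗ᶠ σs) i j →
    Σ (Fin a) λ t₁ → Σ (Fin b) λ t₂ → (rectMatrix (ρs t₁) ⊗ rectMatrix (σs t₂)) i j ≡ true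
  inSome-⊗⁻ (t , e) =
    let (t₁ , t₂) = remQuot {a} b t
    in t₁ , t₂ , trans (sym (rectMatrix-⊗ (ρs t₁) (σs t₂) i j)) e

module _ {ρs : Fin r → Rectangle m n} {σs : Fin s → Rectangle m n} {i : Fin m} {j : Fin n} where

  inSome-++⁺ : inSome r ρs i j ⊎ inSome s σs i j → inSome (r + s) (ρs ++ σs) i j
  inSome-++⁺ (inj₁ (t , e)) = t ↑ˡ s ,
    subst (λ u → rectMatrix ([ ρs , σs ]′ u) i j ≡ true) (sym (splitAt-↑ˡ r t s)) e
  inSome-++⁺ (inj₂ (t , e)) = r ↑ʳ t ,
    subst (λ u → rectMatrix ([ ρs , σs ]′ u) i j ≡ true) (sym (splitAt-↑ʳ r s t)) e

  inSome-++⁻ : inSome (r + s) (ρs ++ σs) i j → inSome r ρs i j ⊎ inSome s σs i j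
  inSome-++⁻ (t , e) with splitAt r t
  ... | inj₁ t₁ = inj₁ (t₁ , e)
  ... | inj₂ t₂ = inj₂ (t₂ , e)

BRankAtMost-⊗ : {X : Matrix m n} {Y : Matrix p q} →
  BRankAtMost X a → BRankAtMost Y b → BRankAtMost (X ⊗ Y) (a * b)
BRankAtMost-⊗ {m = m} {n} {p} {q} {a} {b} {X} {Y} (ρs , ρs-cover) (σs , σs-cover) =
  ρs ⊗ᶠ σs , λ i j → covered i j , sound i j
  where
  covered : ∀ i j → (X ⊗ Y) i j ≡ true → inSome (a * b) (ρs ⊗ᶠ σs) i j
  covered i j e =
    let (t₁ , e₁) = proj₁ (ρs-cover _ _) (∧-conicalˡ (X _ _) (Y _ _) e)
        (t₂ , e₂) = proj₁ (σs-cover _ _) (∧-conicalʳ (X _ _) (Y _ _) e)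
    in inSome-⊗⁺ ρs σs i j t₁ t₂ (∧-true e₁ e₂)

  sound : ∀ i j → inSome (a * b) (ρs ⊗ᶠ σs) i j → (X ⊗ Y) i j ≡ true
  sound i j c =
    let (t₁ , t₂ , e) = inSome-⊗⁻ ρs σs i j c
        (i₁ , i₂) = remQuot {m} p i
        (j₁ , j₂) = remQuot {n} q j
    in ∧-true (proj₂ (ρs-cover i₁ j₁) (t₁ , ∧-conicalˡ (rectMatrix (ρs t₁) i₁ j₁) _ e))
              (proj₂ (σs-cover i₂ j₂) (t₂ , ∧-conicalʳ (rectMatrix (ρs t₁) i₁ j₁) _ e))

BRankAtMost-∨ : {X Y Z : Matrix m n} →
  BRankAtMost X r → BRankAtMost Y s → Covers2 X Y Z → BRankAtMost Z (r + s)
BRankAtMost-∨ {X = X} (ρs , ρs-cover) (σs , σs-cover) Z≡X∨Y = ρs ++ σs , λ i j →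
    (λ e → inSome-++⁺ (⊎-map (proj₁ (ρs-cover i j)) (proj₁ (σs-cover i j))
                        (∨-true⁻ (X i j) (trans (sym (Z≡X∨Y i j)) e))))
  , (λ c → trans (Z≡X∨Y i j)
                 (∨-true⁺ (⊎-map (proj₂ (ρs-cover i j)) (proj₂ (σs-cover i j)) (inSome-++⁻ c))))

pairwiseCovers-⊗ : (A₁ A₂ A₃ : Matrix m n) (B₁ B₂ B₃ : Matrix p q) {A : Matrix m n} {B : Matrix p q} →
  Covers2 A₁ A₂ A → Covers2 A₁ A₃ A → Covers2 A₂ A₃ A →
  Covers2 B₁ B₂ B → Covers2 B₁ B₃ B → Covers2 B₂ B₃ B →
  Covers2 (λ i j → (A₁ ⊗ B₁) i j ∨ (A₂ ⊗ B₂) i j) (A₃ ⊗ B₃) (A ⊗ B)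
pairwiseCovers-⊗ {m = m} {n} {p} {q} A₁ A₂ A₃ B₁ B₂ B₃ A₁₂ A₁₃ A₂₃ B₁₂ B₁₃ B₂₃ i j =
  let (i₁ , i₂) = remQuot {m} p i
      (j₁ , j₂) = remQuot {n} q j
  in pairwiseCover-∧ (A₁ i₁ j₁) (A₂ i₁ j₁) (A₃ i₁ j₁) (B₁ i₂ j₂) (B₂ i₂ j₂) (B₃ i₂ j₂)
       (A₁₂ i₁ j₁ , A₁₃ i₁ j₁ , A₂₃ i₁ j₁)
       (B₁₂ i₂ j₂ , B₁₃ i₂ j₂ , B₂₃ i₂ j₂)

corollary2 : ∀ {m n p q} (A : Matrix m n) (B : Matrix p q)
    (a₁ a₂ a₃ b₁ b₂ b₃ : ℕ) →
    Coverable A a₁ a₂ a₃ → Coverable B b₁ b₂ b₃ →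
    BRankAtMost (A ⊗ B) (a₁ * b₁ + a₂ * b₂ + a₃ * b₃)
corollary2 A B a₁ a₂ a₃ b₁ b₂ b₃
  (A₁ , A₂ , A₃ , rkA₁ , rkA₂ , rkA₃ , A₁₂ , A₁₃ , A₂₃)
  (B₁ , B₂ , B₃ , rkB₁ , rkB₂ , rkB₃ , B₁₂ , B₁₃ , B₂₃) =
  BRankAtMost-∨ (BRankAtMost-∨ (BRankAtMost-⊗ rkA₁ rkB₁) (BRankAtMost-⊗ rkA₂ rkB₂) (λ _ _ → refl))
                (BRankAtMost-⊗ rkA₃ rkB₃)
                (pairwiseCovers-⊗ A₁ A₂ A₃ B₁ B₂ B₃ A₁₂ A₁₃ A₂₃ B₁₂ B₁₃ B₂₃)
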